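{- Let $m\ge 2$, $\ell\ge 0$, and let $T$ be an $m$-reduced zigzag stack on $[\ell]$. Then: (1) $T$ is of type $T_1$. (2) $T$ is of type $T_2$ if and only if $T$ is empty, or $T$ consists of at most $m-3$ isolated vertices, or $\ell\ge m-2$, the vertices $1,\dots,m-2$ are isolated and the substructure on $\{m-1,\dots,\ell\}$ is of type $G$. (3) $T$ is of type $T_3$ if and only if either $m-2\le\ell\le 2m-5$ and all vertices are isolated, or $\ell\ge 2m-4$, the vertices $1,\dots,m-2$ and $\ell-m+3,\dots,\ell$ are isolated and the substructure on $\{m-1,\dots,\ell-m+2\}$ is of type $H$. (4) $T$ is of type $T_4$ if and only if either $\ell\le m-2$ and all vertices are isolated, or $\ell\ge m-1$ and the vertices $1,\dots,m-1$ are isolated. (5) $T$ is of type $T_5$ if and only if either $m-1\le \ell\le 2m-4$ and all vertices are isolated, or $\ell\ge 2m-3$, the vertices $1,\dots,m-1$ and $\ell-m+3,\dots,\ell$ are isolated, and the substructure on $\{m,\dots,\ell-m+2\}$ is empty or has its last vertex of degree at most $1$. (6) $T$ is of type $T_6$ if and only if either $m-1\le\ell\le 2m-3$ and all vertices are isolated, or $\ell\ge 2m-2$ and the vertices $1,\dots,m-1$ and $\ell-m+2,\dots,\ell$ are isolated.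
   Context: $[n]=\{1,\dots,n\}$. A diagram is a simple graph on vertices placed in increasing order on a line; edge $\{i,j\}$, $i<j$, is an arc $(i,j)$; arcs $(i_1,j_1),(i_2,j_2)$ cross if $i_1<i_2<j_1<j_2$; a stack has no crossing arcs. $\mathrm{ld}(v)$ (resp. $\mathrm{rd}(v)$) is the number of arcs $(i,v)$, $i<v$ (resp. $(v,j)$, $j>v$), $\deg=\mathrm{ld}+\mathrm{rd}$. A zigzag stack is a stack with all degrees $\le2$ and no vertex with both $\mathrm{ld}>0$ and $\mathrm{rd}>0$. A zigzag stack on $[n]$ is $m$-reduced if $\mathrm{ld}(i)+\mathrm{rd}(i+m-1)\le2$ for $1\le i\le n-m+1$, and $j-i\ge m-1$ whenever $1\le i<j\le n$, $\mathrm{ld}(i)>0$, $\mathrm{rd}(j)>0$. The substructure of $T$ on $\{p,\dots,q\}$ is the diagram on $[q-p+1]$ with arcs $(i-p+1,j-p+1)$ for arcs $(i,j)$ of $T$ with $p\le i<j\le q$ (empty if $q<p$). An $m$-reduced zigzag stack on $[k]$ ($k\ge0$) is of type $G$ if $k=0$ or $\deg(1)\le1$, and of type $H$ if $k=0$ or ($\deg(1)\le1$ and $\deg(k)\le1$). Boundary types: for $a,b\in\{0,1,2\}$, $T$ on $[\ell]$ is of type $(a,b)$ if, on vertex set $\{0,\dots,\ell+1\}$ with $\lambda(0)=a,\rho(0)=0$, $\lambda(k)=\mathrm{ld}_T(k),\rho(k)=\mathrm{rd}_T(k)$ ($1\le k\le\ell$), $\lambda(\ell+1)=0,\rho(\ell+1)=b$: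 (i) $\lambda(i)+\rho(i+m-1)\le2$ for all $0\le i\le\ell+2-m$; (ii) $j-i\ge m-1$ for all $0\le i<j\le\ell+1$ with $\lambda(i)>0,\rho(j)>0$. $T_1=(0,0)$, $T_2=(1,0)$, $T_3=(1,1)$, $T_4=(2,0)$, $T_5=(2,1)$, $T_6=(2,2)$. -}

module Defs where

open import Data.Bool using (Bool; true; false; if_then_else_; _∧_; T)
open import Data.Nat using (ℕ; zero; suc; _+_; _∸_; _≤_; _<_; _≤ᵇ_; _<ᵇ_; _≡ᵇ_; _≤?_; _≟_)
open import Data.Nat.Properties using (≤ᵇ⇒≤; <ᵇ⇒<)
open import Data.Product using (_×_; _,_)
open import Data.Sum using (_⊎_)
open import Relation.Nullary using (¬_; yes; no)
open import Relation.Binary.PropositionalEquality using (_≡_; refl)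

-- A diagram on [n] = {1,…,n}: a simple graph given by its set of arcs (i , j), i < j,
-- encoded by a Boolean-valued arc relation that only holds for 1 ≤ i < j ≤ n.
record Diagram (n : ℕ) : Set where
  field
    arc : ℕ → ℕ → Bool
    wf  : ∀ i j → arc i j ≡ true → (1 ≤ i) × (i < j) × (j ≤ n)
open Diagram public

countBelow : (ℕ → Bool) → ℕ → ℕ
countBelow f zero = 0
countBelow f (suc v) = countBelow f v + (if f v then 1 else 0)

ld : ∀ {n} → Diagram n → ℕ → ℕ
ld D v = countBelow (λ i → arc D i v) v

rd : ∀ {n} → Diagram n → ℕ → ℕ
rd {n} D v = countBelow (λ j → arc D v j) (suc n)

deg : ∀ {n} → Diagram n → ℕ → ℕ
deg D v = ld D v + rd D v

IsStack : ∀ {n} → Diagram n → Set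
IsStack D = ∀ i₁ j₁ i₂ j₂ → arc D i₁ j₁ ≡ true → arc D i₂ j₂ ≡ true →
  ¬ ((i₁ < i₂) × (i₂ < j₁) × (j₁ < j₂))

IsZigzagStack : ∀ {n} → Diagram n → Set
IsZigzagStack D = IsStack D × (∀ v → deg D v ≤ 2) × (∀ v → (ld D v ≡ 0) ⊎ (rd D v ≡ 0))

IsReduced : (m : ℕ) → ∀ {n} → Diagram n → Set
IsReduced m {n} D = IsZigzagStack D
  × (∀ i → 1 ≤ i → i + m ≤ n + 1 → ld D i + rd D (i + m ∸ 1) ≤ 2)
  × (∀ i j → 1 ≤ i → i < j → j ≤ n → 0 < ld D i → 0 < rd D j → i + (m ∸ 1) ≤ j)

isolated : ∀ {n} → Diagram n → ℕ → Set
isolated D v = deg D v ≡ 0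

guard : ℕ → ℕ → ℕ → Bool
guard n a b = (1 ≤ᵇ a) ∧ ((a <ᵇ b) ∧ (b ≤ᵇ n))

restrictWf : ∀ n (f : ℕ → ℕ → Bool) a b → (guard n a b ∧ f a b) ≡ true →
  (1 ≤ a) × (a < b) × (b ≤ n)
restrictWf n f a b eq with 1 ≤ᵇ a in e1 | a <ᵇ b in e2 | b ≤ᵇ n in e3
... | true | true | true = ≤ᵇ⇒≤ 1 a (tt' e1) , <ᵇ⇒< a b (tt' e2) , ≤ᵇ⇒≤ b n (tt' e3)
  where
  tt' : ∀ {x} → x ≡ true → T x
  tt' refl = _
restrictWf n f a b () | false | _ | _
restrictWf n f a b () | true | false | _
restrictWf n f a b () | true | true | false

-- substructure on {p,…,q}: a diagram on [q - p + 1] (empty if q < p); p ≥ 1 in all uses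
sub : ∀ {n} → Diagram n → (p q : ℕ) → Diagram (suc q ∸ p)
sub D p q = record
  { arc = λ a b → guard (suc q ∸ p) a b ∧ arc D (a + p ∸ 1) (b + p ∸ 1)
  ; wf  = λ a b → restrictWf (suc q ∸ p) (λ a b → arc D (a + p ∸ 1) (b + p ∸ 1)) a b }

IsTypeG : (m : ℕ) → ∀ {k} → Diagram k → Set
IsTypeG m {k} D = IsReduced m D × ((k ≡ 0) ⊎ (deg D 1 ≤ 1))

IsTypeH : (m : ℕ) → ∀ {k} → Diagram k → Set
IsTypeH m {k} D = IsReduced m D × ((k ≡ 0) ⊎ ((deg D 1 ≤ 1) × (deg D k ≤ 1)))

lam : ∀ {ℓ} → Diagram ℓ → (a : ℕ) → ℕ → ℕ
lam D a zero = a
lam {ℓ} D a (suc k) with suc k ≤? ℓ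
... | yes _ = ld D (suc k)
... | no _ = 0

rho : ∀ {ℓ} → Diagram ℓ → (b : ℕ) → ℕ → ℕ
rho D b zero = 0
rho {ℓ} D b (suc k) with suc k ≤? ℓ
... | yes _ = rd D (suc k)
... | no _ with k ≟ ℓ
...   | yes _ = b
...   | no _ = 0

HasType : (m : ℕ) → ∀ {ℓ} → Diagram ℓ → (a b : ℕ) → Set
HasType m {ℓ} D a b =
  (∀ i → i + m ≤ ℓ + 2 → lam D a i + rho D b (i + m ∸ 1) ≤ 2)
  × (∀ i j → i < j → j ≤ ℓ + 1 → 0 < lam D a i → 0 < rho D b j → i + (m ∸ 1) ≤ j)

EmptyOrLastDegLe1 : ∀ {k} → Diagram k → Set
EmptyOrLastDegLe1 {k} D = (k ≡ 0) ⊎ (deg D k ≤ 1)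

module Submission where

-- Among the conditions (i) and (ii) defining boundary type (a , b), those not involving the
-- virtual end vertices 0 and ℓ + 1 are exactly the conditions of m-reducedness, so T has type
-- (a , b) iff six conditions at the two ends hold: load bounds at the vertices m − 1 and
-- ℓ + 2 − m paired with the ends, no arc leaving 1, …, m − 2 (if a > 0) or entering
-- ℓ + 3 − m, …, ℓ (if b > 0), and enough distance between the ends when both are loaded.
-- Arcs point rightwards, so if no arc leaves an initial segment of vertices, that segment is
-- isolated, and symmetrically at the right end. Deleting isolated end segments leaves an
-- m-reduced zigzag stack whose end vertices have degrees rd(m − 1) and ld(ℓ + 2 − m), which turns
-- the load bounds into the conditions of types G and H; comparing ℓ with 2m decides whether the
-- isolated end segments cover all of [ℓ].

open import Defs
open import Data.Nat using (ℕ; zero; suc; _+_; _*_; _∸_; _≤_; _<_; z≤n; s≤s; s≤s⁻¹; z<s; _≤?_; _≟_)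
open import Data.Nat.Properties
open import Data.Bool using (true; false; _∧_)
open import Data.Bool.Properties using (¬-not; T-≡)
open import Data.Product using (_×_; _,_; proj₁; proj₂)
open import Data.Sum using (_⊎_; inj₁; inj₂; [_,_]′)
import Data.Sum as Sum
open import Function.Bundles using (_⇔_; mk⇔; Equivalence)
open import Function.Properties.Equivalence using () renaming (trans to ⇔-trans)
open import Relation.Nullary using (¬_; Dec; yes; no; contradiction)
open import Relation.Binary.PropositionalEquality
  using (_≡_; _≢_; refl; sym; trans; cong; cong₂; subst; subst₂; module ≡-Reasoning)

open Equivalence using (to; from)

∸≤⇔≤+ : ∀ a b c → (a ∸ b ≤ c) ⇔ (a ≤ b + c)
∸≤⇔≤+ a b c = mk⇔ (λ le → ≤-trans (m≤n+m∸n a b) (+-monoʳ-≤ b le)) (m≤n+o⇒m∸n≤o a b)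

+[1+n]∸1 : ∀ m n → m + suc n ∸ 1 ≡ m + n
+[1+n]∸1 m n = cong (_∸ 1) (+-suc m n)

≤+1-cases : ∀ {j ℓ} → j ≤ ℓ + 1 → j ≤ ℓ ⊎ j ≡ suc ℓ
≤+1-cases {j} {ℓ} j≤ℓ+1 with m≤n⇒m<n∨m≡n (subst (j ≤_) (+-comm ℓ 1) j≤ℓ+1)
... | inj₁ j<1+ℓ = inj₁ (s≤s⁻¹ j<1+ℓ)
... | inj₂ j≡1+ℓ = inj₂ j≡1+ℓ

≡0-by-contradiction : ∀ {x} → ¬ (0 < x) → x ≡ 0
≡0-by-contradiction x≯0 = n≤0⇒n≡0 (≮⇒≥ x≯0)

+0≤2 : ∀ {a x} → a ≤ 2 → x ≡ 0 → a + x ≤ 2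
+0≤2 {a} a≤2 refl = subst (_≤ 2) (sym (+-identityʳ a)) a≤2

0+≤2 : ∀ {x b} → b ≤ 2 → x ≡ 0 → x + b ≤ 2
0+≤2 b≤2 refl = b≤2

2+≤2⇒≡0 : ∀ {x} → 2 + x ≤ 2 → x ≡ 0
2+≤2⇒≡0 le = n≤0⇒n≡0 (s≤s⁻¹ (s≤s⁻¹ le))

+1≤2⇔≤1 : ∀ {x} → (x + 1 ≤ 2) ⇔ (x ≤ 1)
+1≤2⇔≤1 {x} = mk⇔ (λ le → s≤s⁻¹ (subst (_≤ 2) (+-comm x 1) le))
                  (λ le → subst (_≤ 2) (+-comm 1 x) (s≤s le))

⊎-×-⇔ : ∀ {P A B A′ B′ : Set} →
  (P ⊎ A) ⇔ A′ → (P ⊎ B) ⇔ B′ → (P ⊎ (A × B)) ⇔ (A′ × B′)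
⊎-×-⇔ {P} {A} {B} PA PB = mk⇔
  [ (λ p → to PA (inj₁ p) , to PB (inj₁ p)) , (λ (a , b) → to PA (inj₂ a) , to PB (inj₂ b)) ]′
  (λ (a′ , b′) → combine (from PA a′) (from PB b′))
  where
  combine : P ⊎ A → P ⊎ B → P ⊎ (A × B)
  combine (inj₁ p) _        = inj₁ p
  combine (inj₂ _) (inj₁ p) = inj₁ p
  combine (inj₂ a) (inj₂ b) = inj₂ (a , b)

-- Counting

countBelow-≡0 : ∀ f n → (∀ i → i < n → f i ≡ false) → countBelow f n ≡ 0
countBelow-≡0 f zero    _ = refl
countBelow-≡0 f (suc n) h
  rewrite countBelow-≡0 f n (λ i i<n → h i (m<n⇒m<1+n i<n)) | h n ≤-refl = refl

0<countBelow : ∀ f n {i} → i < n → f i ≡ true → 0 < countBelow f n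
0<countBelow f (suc n) {i} i<1+n fi with m<1+n⇒m<n∨m≡n i<1+n
... | inj₁ i<n  = ≤-trans (0<countBelow f n i<n fi) (m≤m+n _ _)
... | inj₂ refl rewrite fi = m≤n+m 1 _

countBelow-cong : ∀ f g n → (∀ i → i < n → f i ≡ g i) → countBelow f n ≡ countBelow g n
countBelow-cong f g zero    _ = refl
countBelow-cong f g (suc n) h
  rewrite countBelow-cong f g n (λ i i<n → h i (m<n⇒m<1+n i<n)) | h n ≤-refl = refl

countBelow-+ : ∀ f a b → countBelow f (a + b) ≡ countBelow f a + countBelow (λ i → f (a + i)) b
countBelow-+ f a zero    rewrite +-identityʳ a = sym (+-identityʳ _)
countBelow-+ f a (suc b) rewrite +-suc a b | countBelow-+ f a b =
  +-assoc (countBelow f a) (countBelow (λ i → f (a + i)) b) _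

countBelow-window : ∀ f d w {N} → d + w ≤ N →
  (∀ i → i < d → f i ≡ false) → (∀ i → d + w ≤ i → f i ≡ false) →
  countBelow f N ≡ countBelow (λ i → f (d + i)) w
countBelow-window f d w {N} d+w≤N below above = begin
  countBelow f N
    ≡⟨ cong (countBelow f) (sym (m+[n∸m]≡n d+w≤N)) ⟩
  countBelow f (d + w + (N ∸ (d + w)))
    ≡⟨ countBelow-+ f (d + w) _ ⟩
  countBelow f (d + w) + countBelow (λ i → f (d + w + i)) (N ∸ (d + w))
    ≡⟨ cong₂ _+_ (countBelow-+ f d w)
                 (countBelow-≡0 _ (N ∸ (d + w)) λ i _ → above (d + w + i) (m≤m+n (d + w) i)) ⟩
  countBelow f d + countBelow (λ i → f (d + i)) w + 0
    ≡⟨ cong (λ x → x + countBelow (λ i → f (d + i)) w + 0) (countBelow-≡0 f d below) ⟩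
  countBelow (λ i → f (d + i)) w + 0
    ≡⟨ +-identityʳ _ ⟩
  countBelow (λ i → f (d + i)) w ∎
  where open ≡-Reasoning

-- Degrees and isolated vertices

module _ {n : ℕ} (D : Diagram n) where

  arc-false : ∀ {i j} → ¬ ((1 ≤ i) × (i < j) × (j ≤ n)) → arc D i j ≡ false
  arc-false outside = ¬-not λ e → outside (wf D _ _ e)

  arc⇒0<ld : ∀ {i j} → arc D i j ≡ true → 0 < ld D j
  arc⇒0<ld e with wf D _ _ e
  ... | _ , i<j , _ = 0<countBelow _ _ i<j e

  arc⇒0<rd : ∀ {i j} → arc D i j ≡ true → 0 < rd D i
  arc⇒0<rd e with wf D _ _ e
  ... | _ , _ , j≤n = 0<countBelow _ _ (s≤s j≤n) e

  ld≡0⇒arc≡false : ∀ {i j} → ld D j ≡ 0 → arc D i j ≡ false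
  ld≡0⇒arc≡false ld≡0 = ¬-not λ e → <-irrefl (sym ld≡0) (arc⇒0<ld e)

  rd≡0⇒arc≡false : ∀ {i j} → rd D i ≡ 0 → arc D i j ≡ false
  rd≡0⇒arc≡false rd≡0 = ¬-not λ e → <-irrefl (sym rd≡0) (arc⇒0<rd e)

  isolated⇒ld≡0 : ∀ v → isolated D v → ld D v ≡ 0
  isolated⇒ld≡0 v = m+n≡0⇒m≡0 (ld D v)

  isolated⇒rd≡0 : ∀ v → isolated D v → rd D v ≡ 0
  isolated⇒rd≡0 v = m+n≡0⇒n≡0 (ld D v)

  isolated-intro : ∀ v → ld D v ≡ 0 → rd D v ≡ 0 → isolated D v
  isolated-intro v ld≡0 rd≡0 = cong₂ _+_ ld≡0 rd≡0

  inside-or-isolated : ∀ v → (1 ≤ v × v ≤ n) ⊎ isolated D v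
  inside-or-isolated zero =
    inj₂ (isolated-intro 0 refl (countBelow-≡0 (arc D 0) (suc n) λ j _ → arc-false λ ()))
  inside-or-isolated (suc v) with suc v ≤? n
  ... | yes v≤n = inj₁ (z<s , v≤n)
  ... | no  v≰n = inj₂ (isolated-intro (suc v)
    (countBelow-≡0 (λ i → arc D i (suc v)) (suc v) λ i _ → arc-false λ (_ , _ , v≤n) → v≰n v≤n)
    (countBelow-≡0 (arc D (suc v)) (suc n) λ j _ →
      arc-false λ (_ , v<j , j≤n) → v≰n (≤-trans (<⇒≤ v<j) j≤n)))

  0<ld⇒inside : ∀ {v} → 0 < ld D v → 1 ≤ v × v ≤ n
  0<ld⇒inside {v} pos with inside-or-isolated v
  ... | inj₁ inside = inside
  ... | inj₂ iso    = contradiction (isolated⇒ld≡0 v iso) (m<n⇒n≢0 pos)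

  0<rd⇒inside : ∀ {v} → 0 < rd D v → 1 ≤ v × v ≤ n
  0<rd⇒inside {v} pos with inside-or-isolated v
  ... | inj₁ inside = inside
  ... | inj₂ iso    = contradiction (isolated⇒rd≡0 v iso) (m<n⇒n≢0 pos)

  isolated-outside : ∀ v → (1 ≤ v → v ≤ n → isolated D v) → isolated D v
  isolated-outside v inside with inside-or-isolated v
  ... | inj₁ (1≤v , v≤n) = inside 1≤v v≤n
  ... | inj₂ iso         = iso

  ld≡0-after : ∀ K → (∀ j → j ≤ K → rd D j ≡ 0) → ∀ v → v ≤ suc K → ld D v ≡ 0
  ld≡0-after K rd≡0 v v≤1+K = countBelow-≡0 (λ i → arc D i v) v λ i i<v →
    rd≡0⇒arc≡false (rd≡0 i (s≤s⁻¹ (≤-trans i<v v≤1+K)))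

  rd≡0-before : ∀ t → (∀ i → t ≤ i → ld D i ≡ 0) → ∀ v → t ≤ suc v → rd D v ≡ 0
  rd≡0-before t ld≡0 v t≤1+v = countBelow-≡0 (arc D v) (suc n) λ j _ → ¬-not λ e →
    <-irrefl (sym (ld≡0 j (≤-trans t≤1+v (proj₁ (proj₂ (wf D v j e)))))) (arc⇒0<ld e)

  isolated-below : ∀ K → (∀ j → j ≤ K → rd D j ≡ 0) → ∀ v → v ≤ K → isolated D v
  isolated-below K rd≡0 v v≤K =
    isolated-intro v (ld≡0-after K rd≡0 v (m≤n⇒m≤1+n v≤K)) (rd≡0 v v≤K)

  isolated-from : ∀ t → (∀ i → t ≤ i → ld D i ≡ 0) → ∀ v → t ≤ v → isolated D v
  isolated-from t ld≡0 v t≤v =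
    isolated-intro v (ld≡0 v t≤v) (rd≡0-before t ld≡0 v (m≤n⇒m≤1+n t≤v))

  isolated-beyond : ∀ v → n < v → isolated D v
  isolated-beyond v n<v = isolated-outside v λ _ v≤n → contradiction v≤n (<⇒≱ n<v)

  isolated-everywhere : ∀ K t → t ≤ suc K →
    (∀ v → v ≤ K → isolated D v) → (∀ v → t ≤ v → isolated D v) → ∀ v → isolated D v
  isolated-everywhere K t t≤1+K below above v with v ≤? K
  ... | yes v≤K = below v v≤K
  ... | no  v≰K = above v (≤-trans t≤1+K (≰⇒> v≰K))

  lam≡ld : ∀ a {i} → 1 ≤ i → lam D a i ≡ ld D i
  lam≡ld a {suc i} _ with suc i ≤? n
  ... | yes _   = refl
  ... | no  i≰n =
    sym (isolated⇒ld≡0 (suc i) (isolated-outside (suc i) λ _ i≤n → contradiction i≤n i≰n))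

  rho≡rd : ∀ b {j} → j ≤ n → rho D b j ≡ rd D j
  rho≡rd b {zero}  _   = sym (isolated⇒rd≡0 0 (isolated-outside 0 λ ()))
  rho≡rd b {suc j} j≤n with suc j ≤? n
  ... | yes _   = refl
  ... | no  j≰n = contradiction j≤n j≰n

  rho-last : ∀ b → rho D b (suc n) ≡ b
  rho-last b with suc n ≤? n
  ... | yes n<n = contradiction n<n (<-irrefl refl)
  ... | no  _ with n ≟ n
  ...   | yes _   = refl
  ...   | no  n≢n = contradiction refl n≢n

-- Cutting off isolated ends

guard-true : ∀ N {a b} → 1 ≤ a → a < b → b ≤ N → guard N a b ≡ true
guard-true N 1≤a a<b b≤N
  rewrite to T-≡ (≤⇒≤ᵇ 1≤a) | to T-≡ (<⇒<ᵇ a<b) | to T-≡ (≤⇒≤ᵇ b≤N) = refl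

∧-absorbˡ : ∀ {x y} → (y ≡ true → x ≡ true) → x ∧ y ≡ y
∧-absorbˡ {true}          _ = refl
∧-absorbˡ {false} {false} _ = refl
∧-absorbˡ {false} {true}  h = h refl

module Substructure {ℓ : ℕ} (T : Diagram ℓ) (d q : ℕ) (q≤ℓ : q ≤ ℓ)
  (prefix : ∀ v → v ≤ d → isolated T v) (suffix : ∀ v → q < v → isolated T v) where

  k : ℕ
  k = q ∸ d

  S : Diagram k
  S = sub T (suc d) q

  d+k≡q : 1 ≤ k → d + k ≡ q
  d+k≡q 1≤k = m+[n∸m]≡n (<⇒≤ (m∸n≢0⇒n<m {q} {d} (m<n⇒n≢0 1≤k)))

  d+a≤ℓ : ∀ {a} → 1 ≤ a → a ≤ k → d + a ≤ ℓ
  d+a≤ℓ 1≤a a≤k =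
    ≤-trans (+-monoʳ-≤ d a≤k) (≤-trans (≤-reflexive (d+k≡q (≤-trans 1≤a a≤k))) q≤ℓ)

  shift : ∀ i → i + suc d ∸ 1 ≡ d + i
  shift i = trans (+[1+n]∸1 i d) (+-comm i d)

  no-arc-from-prefix : ∀ {i} j → i ≤ d → arc T i j ≡ false
  no-arc-from-prefix {i} j i≤d = rd≡0⇒arc≡false T (isolated⇒rd≡0 T i (prefix i i≤d))

  no-arc-into-suffix : ∀ i {j} → q < j → arc T i j ≡ false
  no-arc-into-suffix i {j} q<j = ld≡0⇒arc≡false T (isolated⇒ld≡0 T j (suffix j q<j))

  arc⇒in-window : ∀ i {j} → j ≤ k → arc T (d + i) (d + j) ≡ true → guard k i j ≡ true
  arc⇒in-window zero    j≤k e =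
    contradiction (trans (sym e) (no-arc-from-prefix _ (≤-reflexive (+-identityʳ d)))) λ ()
  arc⇒in-window (suc i) j≤k e =
    guard-true k z<s (+-cancelˡ-< d (suc i) _ (proj₁ (proj₂ (wf T _ _ e)))) j≤k

  sub-arc : ∀ i {j} → j ≤ k → arc S i j ≡ arc T (d + i) (d + j)
  sub-arc i {j} j≤k = trans (cong₂ (λ x y → guard k i j ∧ arc T x y) (shift i) (shift j))
                            (∧-absorbˡ (arc⇒in-window i j≤k))

  sub-ld : ∀ {a} → a ≤ k → ld S a ≡ ld T (d + a)
  sub-ld {a} a≤k = begin
    ld S a
      ≡⟨ countBelow-cong (λ i → arc S i a) (λ i → arc T (d + i) (d + a)) a (λ i _ → sub-arc i a≤k) ⟩
    countBelow (λ i → arc T (d + i) (d + a)) a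
      ≡⟨ sym (countBelow-window (λ i → arc T i (d + a)) d a ≤-refl below above) ⟩
    ld T (d + a) ∎
    where
    open ≡-Reasoning
    below : ∀ i → i < d → arc T i (d + a) ≡ false
    below i i<d = no-arc-from-prefix _ (<⇒≤ i<d)
    above : ∀ i → d + a ≤ i → arc T i (d + a) ≡ false
    above i d+a≤i = arc-false T λ (_ , i<d+a , _) → <⇒≱ i<d+a d+a≤i

  sub-rd : ∀ {a} → 1 ≤ a → a ≤ k → rd S a ≡ rd T (d + a)
  sub-rd {a} 1≤a a≤k = begin
    rd S a
      ≡⟨ countBelow-cong (arc S a) (λ j → arc T (d + a) (d + j)) (suc k)
                         (λ j j<1+k → sub-arc a (s≤s⁻¹ j<1+k)) ⟩
    countBelow (λ j → arc T (d + a) (d + j)) (suc k)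
      ≡⟨ sym (countBelow-window (arc T (d + a)) d (suc k)
                                (subst (_≤ suc ℓ) (sym d+1+k≡1+q) (s≤s q≤ℓ)) below above) ⟩
    rd T (d + a) ∎
    where
    open ≡-Reasoning
    d+1+k≡1+q : d + suc k ≡ suc q
    d+1+k≡1+q = trans (+-suc d k) (cong suc (d+k≡q (≤-trans 1≤a a≤k)))
    below : ∀ j → j < d → arc T (d + a) j ≡ false
    below j j<d = arc-false T λ (_ , d+a<j , _) → <-asym (≤-<-trans (m≤m+n d a) d+a<j) j<d
    above : ∀ j → d + suc k ≤ j → arc T (d + a) j ≡ false
    above j le = no-arc-into-suffix _ (subst (_≤ j) d+1+k≡1+q le)

  sub-deg : ∀ {a} → 1 ≤ a → a ≤ k → deg S a ≡ deg T (d + a)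
  sub-deg 1≤a a≤k = cong₂ _+_ (sub-ld a≤k) (sub-rd 1≤a a≤k)

  sub-reduced : ∀ m → IsReduced (suc m) T → IsReduced (suc m) S
  sub-reduced m ((stack , deg≤2 , zigzag) , loads , gaps) =
    (sub-stack , sub-deg≤2 , sub-zigzag) , sub-loads , sub-gaps
    where
    arcS⇒arcT : ∀ {i j} → arc S i j ≡ true → arc T (d + i) (d + j) ≡ true
    arcS⇒arcT {i} {j} e = trans (sym (sub-arc i (proj₂ (proj₂ (wf S i j e))))) e

    sub-stack : IsStack S
    sub-stack i₁ j₁ i₂ j₂ e₁ e₂ (p , q , r) =
      stack _ _ _ _ (arcS⇒arcT e₁) (arcS⇒arcT e₂) (+-monoʳ-< d p , +-monoʳ-< d q , +-monoʳ-< d r)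

    sub-deg≤2 : ∀ v → deg S v ≤ 2
    sub-deg≤2 v with inside-or-isolated S v
    ... | inj₁ (1≤v , v≤k) = subst (_≤ 2) (sym (sub-deg 1≤v v≤k)) (deg≤2 (d + v))
    ... | inj₂ iso         = subst (_≤ 2) (sym iso) z≤n

    sub-zigzag : ∀ v → (ld S v ≡ 0) ⊎ (rd S v ≡ 0)
    sub-zigzag v with inside-or-isolated S v
    ... | inj₁ (1≤v , v≤k) = Sum.map (trans (sub-ld v≤k)) (trans (sub-rd 1≤v v≤k)) (zigzag (d + v))
    ... | inj₂ iso         = inj₁ (isolated⇒ld≡0 S v iso)

    sub-loads : ∀ i → 1 ≤ i → i + suc m ≤ k + 1 → ld S i + rd S (i + suc m ∸ 1) ≤ 2
    sub-loads i 1≤i le = subst (_≤ 2) (sym (cong₂ _+_ (sub-ld i≤k) rd-eq))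
      (loads (d + i) (≤-trans 1≤i (m≤n+m i d)) d+i+1+m≤ℓ+1)
      where
      i+m≤k : i + m ≤ k
      i+m≤k = s≤s⁻¹ (subst₂ _≤_ (+-suc i m) (+-comm k 1) le)
      i≤k : i ≤ k
      i≤k = ≤-trans (m≤m+n i m) i+m≤k
      1≤i+m : 1 ≤ i + m
      1≤i+m = ≤-trans 1≤i (m≤m+n i m)
      d+i+1+m≡1+d+[i+m] : d + i + suc m ≡ suc (d + (i + m))
      d+i+1+m≡1+d+[i+m] = trans (+-assoc d i (suc m)) (trans (cong (d +_) (+-suc i m)) (+-suc d (i + m)))
      d+i+1+m≤ℓ+1 : d + i + suc m ≤ ℓ + 1
      d+i+1+m≤ℓ+1 = subst₂ _≤_ (sym d+i+1+m≡1+d+[i+m]) (+-comm 1 ℓ) (s≤s (d+a≤ℓ 1≤i+m i+m≤k))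
      rd-eq : rd S (i + suc m ∸ 1) ≡ rd T (d + i + suc m ∸ 1)
      rd-eq = trans (cong (rd S) (+[1+n]∸1 i m))
                    (trans (sub-rd 1≤i+m i+m≤k) (cong (λ x → rd T (x ∸ 1)) (sym d+i+1+m≡1+d+[i+m])))

    sub-gaps : ∀ i j → 1 ≤ i → i < j → j ≤ k → 0 < ld S i → 0 < rd S j → i + (suc m ∸ 1) ≤ j
    sub-gaps i j 1≤i i<j j≤k 0<ld 0<rd = +-cancelˡ-≤ d _ _ (subst (_≤ d + j) (+-assoc d i m)
      (gaps (d + i) (d + j) (≤-trans 1≤i (m≤n+m i d)) (+-monoʳ-< d i<j) (d+a≤ℓ 1≤j j≤k)
        (subst (0 <_) (sub-ld (≤-trans (<⇒≤ i<j) j≤k)) 0<ld)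
        (subst (0 <_) (sub-rd 1≤j j≤k) 0<rd)))
      where
      1≤j : 1 ≤ j
      1≤j = ≤-trans 1≤i (<⇒≤ i<j)

  empty⇒isolated : k ≡ 0 → ∀ v → isolated T v
  empty⇒isolated k≡0 = isolated-everywhere T d (suc q) (s≤s (m∸n≡0⇒m≤n k≡0)) prefix suffix

  deg-first : 1 ≤ k → deg S 1 ≡ rd T (suc d)
  deg-first 1≤k = begin
    deg S 1                      ≡⟨ sub-deg ≤-refl 1≤k ⟩
    deg T (d + 1)                ≡⟨ cong (deg T) (+-comm d 1) ⟩
    ld T (suc d) + rd T (suc d)  ≡⟨ cong (_+ rd T (suc d)) (ld≡0-after T d rd≡0 (suc d) ≤-refl) ⟩
    rd T (suc d)                 ∎
    where
    open ≡-Reasoning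
    rd≡0 : ∀ j → j ≤ d → rd T j ≡ 0
    rd≡0 j j≤d = isolated⇒rd≡0 T j (prefix j j≤d)

  deg-last : 1 ≤ k → deg S k ≡ ld T q
  deg-last 1≤k = begin
    deg S k          ≡⟨ sub-deg 1≤k ≤-refl ⟩
    deg T (d + k)    ≡⟨ cong (deg T) (d+k≡q 1≤k) ⟩
    ld T q + rd T q  ≡⟨ cong (ld T q +_) (rd≡0-before T (suc q) ld≡0 q ≤-refl) ⟩
    ld T q + 0       ≡⟨ +-identityʳ _ ⟩
    ld T q           ∎
    where
    open ≡-Reasoning
    ld≡0 : ∀ i → q < i → ld T i ≡ 0
    ld≡0 i q<i = isolated⇒ld≡0 T i (suffix i q<i)

  empty-or-deg≤1⇔ : ∀ a {x} → (1 ≤ k → deg S a ≡ x) → (k ≡ 0 → x ≡ 0) →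
    ((k ≡ 0) ⊎ (deg S a ≤ 1)) ⇔ (x ≤ 1)
  empty-or-deg≤1⇔ a deg≡x x≡0 with k ≟ 0
  ... | yes k≡0 = mk⇔ (λ _ → subst (_≤ 1) (sym (x≡0 k≡0)) z≤n) (λ _ → inj₁ k≡0)
  ... | no  k≢0 = mk⇔ [ (λ k≡0 → contradiction k≡0 k≢0) , subst (_≤ 1) (deg≡x 1≤k) ]′
                      (λ x≤1 → inj₂ (subst (_≤ 1) (sym (deg≡x 1≤k)) x≤1))
    where
    1≤k : 1 ≤ k
    1≤k = n≢0⇒n>0 k≢0

  first-deg≤1⇔ : ((k ≡ 0) ⊎ (deg S 1 ≤ 1)) ⇔ (rd T (suc d) ≤ 1)
  first-deg≤1⇔ =
    empty-or-deg≤1⇔ 1 deg-first λ k≡0 → isolated⇒rd≡0 T (suc d) (empty⇒isolated k≡0 (suc d))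

  last-deg≤1⇔ : ((k ≡ 0) ⊎ (deg S k ≤ 1)) ⇔ (ld T q ≤ 1)
  last-deg≤1⇔ = empty-or-deg≤1⇔ k deg-last λ k≡0 → isolated⇒ld≡0 T q (empty⇒isolated k≡0 q)

  ends-deg≤1⇔ : ((k ≡ 0) ⊎ ((deg S 1 ≤ 1) × (deg S k ≤ 1))) ⇔ ((rd T (suc d) ≤ 1) × (ld T q ≤ 1))
  ends-deg≤1⇔ = ⊎-×-⇔ first-deg≤1⇔ last-deg≤1⇔

-- Boundary types of an m-reduced zigzag stack

module ReducedStack (n ℓ : ℕ) (T : Diagram ℓ) (R : IsReduced (suc (suc n)) T) where

  m : ℕ
  m = suc (suc n)

  Q : ℕ
  Q = ℓ + 2 ∸ m

  1≤m : 1 ≤ m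
  1≤m = z<s

  2≤m : 2 ≤ m
  2≤m = s≤s z<s

  1≤2 : 1 ≤ 2
  1≤2 = z<s

  reduced-loads : ∀ i → 1 ≤ i → i + m ≤ ℓ + 1 → ld T i + rd T (i + m ∸ 1) ≤ 2
  reduced-loads = proj₁ (proj₂ R)

  reduced-gaps : ∀ i j → 1 ≤ i → i < j → j ≤ ℓ → 0 < ld T i → 0 < rd T j → i + (m ∸ 1) ≤ j
  reduced-gaps = proj₂ (proj₂ R)

  deg≤2 : ∀ v → deg T v ≤ 2
  deg≤2 = proj₁ (proj₂ (proj₁ R))

  ld≤2 : ∀ v → ld T v ≤ 2
  ld≤2 v = ≤-trans (m≤m+n (ld T v) (rd T v)) (deg≤2 v)

  rd≤2 : ∀ v → rd T v ≤ 2
  rd≤2 v = ≤-trans (m≤n+m (rd T v) (ld T v)) (deg≤2 v)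

  m≤ℓ+1⇒n<ℓ : m ≤ ℓ + 1 → n < ℓ
  m≤ℓ+1⇒n<ℓ le = s≤s⁻¹ (subst (m ≤_) (+-comm ℓ 1) le)

  n<ℓ⇒m≤ℓ+1 : n < ℓ → m ≤ ℓ + 1
  n<ℓ⇒m≤ℓ+1 lt = subst (m ≤_) (+-comm 1 ℓ) (s≤s lt)

  m≤ℓ+1⇒m≤ℓ+2 : m ≤ ℓ + 1 → m ≤ ℓ + 2
  m≤ℓ+1⇒m≤ℓ+2 le = ≤-trans le (+-monoʳ-≤ ℓ (n≤1+n 1))

  m≤ℓ+1⇒m≢ℓ+2 : m ≤ ℓ + 1 → m ≢ ℓ + 2
  m≤ℓ+1⇒m≢ℓ+2 le eq = <-irrefl eq (≤-<-trans le (+-monoʳ-< ℓ ≤-refl))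

  m≤ℓ+2⇒n≤ℓ : m ≤ ℓ + 2 → n ≤ ℓ
  m≤ℓ+2⇒n≤ℓ le = s≤s⁻¹ (s≤s⁻¹ (subst (m ≤_) (+-comm ℓ 2) le))

  n≤ℓ⇒m≤ℓ+2 : n ≤ ℓ → m ≤ ℓ + 2
  n≤ℓ⇒m≤ℓ+2 le = subst (m ≤_) (+-comm 2 ℓ) (s≤s (s≤s le))

  m≡ℓ+2⇒n≡ℓ : m ≡ ℓ + 2 → n ≡ ℓ
  m≡ℓ+2⇒n≡ℓ eq = suc-injective (suc-injective (trans eq (+-comm ℓ 2)))

  2*m≡m+m : 2 * m ≡ m + m
  2*m≡m+m = cong (m +_) (+-identityʳ m)

  2*m≤ℓ+[c+2]⇒m≤ℓ+c : ∀ c → 2 * m ≤ ℓ + (c + 2) → m ≤ ℓ + c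
  2*m≤ℓ+[c+2]⇒m≤ℓ+c c le = +-cancelʳ-≤ 2 m (ℓ + c)
    (≤-trans (+-monoʳ-≤ m (s≤s z<s)) (subst₂ _≤_ 2*m≡m+m (sym (+-assoc ℓ c 2)) le))

  +m≤ℓ+2⇔ : ∀ i → (i + m ≤ ℓ + 2) ⇔ (i + suc n ≤ suc ℓ)
  +m≤ℓ+2⇔ i = mk⇔ (λ le → s≤s⁻¹ (subst₂ _≤_ (+-suc i (suc n)) (+-comm ℓ 2) le))
                  (λ le → subst₂ _≤_ (sym (+-suc i (suc n))) (+-comm 2 ℓ) (s≤s le))

  right-zone⇔ : ∀ i → (ℓ + 3 ∸ m ≤ i) ⇔ (ℓ + 2 < i + m)
  right-zone⇔ i = mk⇔
    (λ le → subst₂ _≤_ (+-suc ℓ 2) (+-comm m i) (to (∸≤⇔≤+ (ℓ + 3) m i) le))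
    (λ lt → from (∸≤⇔≤+ (ℓ + 3) m i) (subst₂ _≤_ (sym (+-suc ℓ 2)) (+-comm i m) lt))

  1≤Q : m ≤ ℓ + 1 → 1 ≤ Q
  1≤Q m≤ℓ+1 = m<n⇒0<n∸m (≤-trans (s≤s m≤ℓ+1) (≤-reflexive (sym (+-suc ℓ 1))))

  Q+m≡ℓ+2 : m ≤ ℓ + 1 → Q + m ≡ ℓ + 2
  Q+m≡ℓ+2 m≤ℓ+1 = m∸n+n≡m (m≤ℓ+1⇒m≤ℓ+2 m≤ℓ+1)

  Q≤ℓ : Q ≤ ℓ
  Q≤ℓ = from (∸≤⇔≤+ (ℓ + 2) m ℓ) (subst (ℓ + 2 ≤_) (+-comm ℓ m) (+-monoʳ-≤ ℓ (s≤s z<s)))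

  ℓ+3∸m≤1+Q : ℓ + 3 ∸ m ≤ suc Q
  ℓ+3∸m≤1+Q = from (∸≤⇔≤+ (ℓ + 3) m (suc Q))
    (subst₂ _≤_ (sym (+-suc ℓ 2)) (sym (+-suc m Q)) (s≤s (m≤n+m∸n (ℓ + 2) m)))

  Q≤ℓ+3∸m : Q ≤ ℓ + 3 ∸ m
  Q≤ℓ+3∸m = ∸-monoˡ-≤ m (+-monoʳ-≤ ℓ (n≤1+n 2))

  -- The instances of (i) and (ii) for boundary type (a , b) that involve the virtual vertices 0
  -- and ℓ + 1; condition (i) pairs 0 with m − 1 and Q with ℓ + 1.
  record Boundary (a b : ℕ) : Set where
    field
      leftGap   : 0 < a → ∀ j → j ≤ n → rd T j ≡ 0
      rightGap  : 0 < b → ∀ i → ℓ + 3 ∸ m ≤ i → ld T i ≡ 0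
      span      : 0 < a → 0 < b → m ≤ ℓ + 2
      leftLoad  : m ≤ ℓ + 1 → a + rd T (m ∸ 1) ≤ 2
      rightLoad : m ≤ ℓ + 1 → ld T Q + b ≤ 2
      meet      : m ≡ ℓ + 2 → a + b ≤ 2

  hasType⇒boundary : ∀ {a b} → HasType m T a b → Boundary a b
  hasType⇒boundary {a} {b} (loads , gaps) = record
    { leftGap = leftGap ; rightGap = rightGap ; span = span
    ; leftLoad = leftLoad ; rightLoad = rightLoad ; meet = meet }
    where
    1+ℓ≤ℓ+1 : suc ℓ ≤ ℓ + 1
    1+ℓ≤ℓ+1 = ≤-reflexive (+-comm 1 ℓ)

    gap-to-end : ∀ i → i ≤ ℓ → 0 < lam T a i → 0 < b → i + suc n ≤ suc ℓ
    gap-to-end i i≤ℓ 0<λ 0<b =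
      gaps i (suc ℓ) (s≤s i≤ℓ) 1+ℓ≤ℓ+1 0<λ (subst (0 <_) (sym (rho-last T b)) 0<b)

    leftGap : 0 < a → ∀ j → j ≤ n → rd T j ≡ 0
    leftGap 0<a j j≤n = ≡0-by-contradiction λ 0<rd →
      let (1≤j , j≤ℓ) = 0<rd⇒inside T 0<rd in
      ≤⇒≯ j≤n (gaps 0 j 1≤j (≤-trans j≤ℓ (m≤m+n ℓ 1)) 0<a
                (subst (0 <_) (sym (rho≡rd T b j≤ℓ)) 0<rd))

    rightGap : 0 < b → ∀ i → ℓ + 3 ∸ m ≤ i → ld T i ≡ 0
    rightGap 0<b i in-zone = ≡0-by-contradiction λ 0<ld →
      let (1≤i , i≤ℓ) = 0<ld⇒inside T 0<ld in
      <⇒≱ (to (right-zone⇔ i) in-zone) (from (+m≤ℓ+2⇔ i)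
        (gap-to-end i i≤ℓ (subst (0 <_) (sym (lam≡ld T a 1≤i)) 0<ld) 0<b))

    span : 0 < a → 0 < b → m ≤ ℓ + 2
    span 0<a 0<b = n≤ℓ⇒m≤ℓ+2 (s≤s⁻¹ (gap-to-end 0 z≤n 0<a 0<b))

    leftLoad : m ≤ ℓ + 1 → a + rd T (m ∸ 1) ≤ 2
    leftLoad m≤ℓ+1 = subst (λ x → a + x ≤ 2) (rho≡rd T b (m≤ℓ+1⇒n<ℓ m≤ℓ+1))
      (loads 0 (m≤ℓ+1⇒m≤ℓ+2 m≤ℓ+1))

    rightLoad : m ≤ ℓ + 1 → ld T Q + b ≤ 2
    rightLoad m≤ℓ+1 = subst₂ (λ x y → x + y ≤ 2)
      (lam≡ld T a (1≤Q m≤ℓ+1)) (trans (cong (rho T b) end) (rho-last T b))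
      (loads Q (≤-reflexive (Q+m≡ℓ+2 m≤ℓ+1)))
      where
      end : Q + m ∸ 1 ≡ suc ℓ
      end = trans (cong (_∸ 1) (Q+m≡ℓ+2 m≤ℓ+1)) (cong (_∸ 1) (+-comm ℓ 2))

    meet : m ≡ ℓ + 2 → a + b ≤ 2
    meet m≡ℓ+2 = subst (λ x → a + x ≤ 2)
      (trans (cong (λ x → rho T b (suc x)) (m≡ℓ+2⇒n≡ℓ m≡ℓ+2)) (rho-last T b))
      (loads 0 (≤-reflexive m≡ℓ+2))

  module _ {a b : ℕ} (B : Boundary a b) where
    open Boundary B

    boundary⇒inner-load : ∀ i → 1 ≤ i → i + m ≤ ℓ + 2 → ld T i + rho T b (i + m ∸ 1) ≤ 2
    boundary⇒inner-load i 1≤i le with m≤n⇒m<n∨m≡n (to (+m≤ℓ+2⇔ i) le)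
    ... | inj₁ i+1+n<1+ℓ = subst (λ x → ld T i + x ≤ 2) (sym (rho≡rd T b j≤ℓ))
      (reduced-loads i 1≤i (subst₂ _≤_ (sym (+-suc i (suc n))) (+-comm 1 ℓ) i+1+n<1+ℓ))
      where
      j≤ℓ : i + m ∸ 1 ≤ ℓ
      j≤ℓ = subst (_≤ ℓ) (sym (+[1+n]∸1 i (suc n))) (s≤s⁻¹ i+1+n<1+ℓ)
    ... | inj₂ i+1+n≡1+ℓ =
      subst₂ (λ x y → ld T x + y ≤ 2) Q≡i (sym ρ≡b) (rightLoad (n<ℓ⇒m≤ℓ+1 n<ℓ))
      where
      Q≡i : Q ≡ i
      Q≡i = trans (cong (_∸ m) (sym i+m≡ℓ+2)) (m+n∸n≡m i m)
        where
        i+m≡ℓ+2 : i + m ≡ ℓ + 2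
        i+m≡ℓ+2 = subst₂ _≡_ (sym (+-suc i (suc n))) (+-comm 2 ℓ) (cong suc i+1+n≡1+ℓ)
      n<ℓ : n < ℓ
      n<ℓ = s≤s⁻¹ (subst (suc (suc n) ≤_) i+1+n≡1+ℓ (+-monoˡ-≤ (suc n) 1≤i))
      ρ≡b : rho T b (i + m ∸ 1) ≡ b
      ρ≡b = trans (cong (rho T b) (trans (+[1+n]∸1 i (suc n)) i+1+n≡1+ℓ)) (rho-last T b)

    boundary⇒loads : ∀ i → i + m ≤ ℓ + 2 → lam T a i + rho T b (i + m ∸ 1) ≤ 2
    boundary⇒loads zero le with ℓ ≤? n
    ... | no  ℓ≰n =
      subst (λ x → a + x ≤ 2) (sym (rho≡rd T b (≰⇒> ℓ≰n)))
            (leftLoad (n<ℓ⇒m≤ℓ+1 (≰⇒> ℓ≰n)))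
    ... | yes ℓ≤n =
      subst (λ x → a + x ≤ 2) (sym (trans (cong (λ x → rho T b (suc x)) n≡ℓ) (rho-last T b)))
            (meet (trans (cong (2 +_) n≡ℓ) (+-comm 2 ℓ)))
      where
      n≡ℓ : n ≡ ℓ
      n≡ℓ = ≤-antisym (m≤ℓ+2⇒n≤ℓ le) ℓ≤n
    boundary⇒loads (suc i) le = subst (λ x → x + rho T b (suc i + m ∸ 1) ≤ 2) (sym (lam≡ld T a z<s))
                                      (boundary⇒inner-load (suc i) z<s le)

    boundary⇒gaps : ∀ i j → i < j → j ≤ ℓ + 1 → 0 < lam T a i → 0 < rho T b j → i + (m ∸ 1) ≤ j
    boundary⇒gaps i j i<j j≤ℓ+1 0<λ 0<ρ with ≤+1-cases j≤ℓ+1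
    boundary⇒gaps zero j i<j _ 0<a 0<ρ | inj₁ j≤ℓ =
      ≰⇒> λ j≤n → contradiction (leftGap 0<a j j≤n)
                                (m<n⇒n≢0 (subst (0 <_) (rho≡rd T b j≤ℓ) 0<ρ))
    boundary⇒gaps (suc i) j i<j _ 0<λ 0<ρ | inj₁ j≤ℓ =
      reduced-gaps (suc i) j z<s i<j j≤ℓ
        (subst (0 <_) (lam≡ld T a z<s) 0<λ) (subst (0 <_) (rho≡rd T b j≤ℓ) 0<ρ)
    boundary⇒gaps zero .(suc ℓ) _ _ 0<a 0<ρ | inj₂ refl =
      s≤s (m≤ℓ+2⇒n≤ℓ (span 0<a (subst (0 <_) (rho-last T b) 0<ρ)))
    boundary⇒gaps (suc i) .(suc ℓ) _ _ 0<λ 0<ρ | inj₂ refl =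
      to (+m≤ℓ+2⇔ (suc i)) (≮⇒≥ λ ℓ+2<i+m →
        contradiction (rightGap (subst (0 <_) (rho-last T b) 0<ρ) (suc i)
                                (from (right-zone⇔ (suc i)) ℓ+2<i+m))
                      (m<n⇒n≢0 (subst (0 <_) (lam≡ld T a z<s) 0<λ)))

  boundary⇒hasType : ∀ {a b} → Boundary a b → HasType m T a b
  boundary⇒hasType B = boundary⇒loads B , boundary⇒gaps B

  hasType⇔boundary : ∀ a b → HasType m T a b ⇔ Boundary a b
  hasType⇔boundary a b = mk⇔ hasType⇒boundary boundary⇒hasType

  AllIsolated : Set
  AllIsolated = ∀ v → 1 ≤ v → v ≤ ℓ → isolated T v

  PrefixIsolated : ℕ → Set
  PrefixIsolated c = ∀ v → 1 ≤ v → v + c ≤ m → isolated T v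

  SuffixIsolated : ℕ → Set
  SuffixIsolated c = ∀ v → ℓ + c ≤ v + m → v ≤ ℓ → isolated T v

  allIsolated⇔ : AllIsolated ⇔ (∀ v → isolated T v)
  allIsolated⇔ = mk⇔ (λ all v → isolated-outside T v (all v)) (λ all v _ _ → all v)

  prefixIsolated⇔ : ∀ c → c ≤ m → PrefixIsolated c ⇔ (∀ v → v ≤ m ∸ c → isolated T v)
  prefixIsolated⇔ c c≤m = mk⇔
    (λ pre v v≤ → isolated-outside T v λ 1≤v _ → pre v 1≤v (m≤o∸n⇒m+n≤o v c≤m v≤))
    (λ pre v _ le → pre v (m+n≤o⇒m≤o∸n v le))

  suffixIsolated⇔ : ∀ c → SuffixIsolated c ⇔ (∀ v → ℓ + c ∸ m ≤ v → isolated T v)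
  suffixIsolated⇔ c = mk⇔
    (λ suf v le → isolated-outside T v λ _ v≤ℓ →
      suf v (subst (ℓ + c ≤_) (+-comm m v) (to (∸≤⇔≤+ (ℓ + c) m v) le)) v≤ℓ)
    (λ suf v le _ → suf v (from (∸≤⇔≤+ (ℓ + c) m v) (subst (ℓ + c ≤_) (+-comm v m) le)))

  boundary-of-isolated : ∀ {a b} → (∀ v → isolated T v) → a ≤ 2 → b ≤ 2 →
    (0 < a → 0 < b → m ≤ ℓ + 2) → (m ≡ ℓ + 2 → a + b ≤ 2) → Boundary a b
  boundary-of-isolated iso a≤2 b≤2 span meet = record
    { leftGap   = λ _ j _ → isolated⇒rd≡0 T j (iso j)
    ; rightGap  = λ _ i _ → isolated⇒ld≡0 T i (iso i)
    ; span      = span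
    ; leftLoad  = λ _ → +0≤2 a≤2 (isolated⇒rd≡0 T (m ∸ 1) (iso (m ∸ 1)))
    ; rightLoad = λ _ → 0+≤2 b≤2 (isolated⇒ld≡0 T Q (iso Q))
    ; meet      = meet }

  leftLoad′ : ∀ {a b} → a ≤ 2 → Boundary a b → a + rd T (m ∸ 1) ≤ 2
  leftLoad′ a≤2 B with m ≤? ℓ + 1
  ... | yes m≤ℓ+1 = Boundary.leftLoad B m≤ℓ+1
  ... | no  m≰ℓ+1 = +0≤2 a≤2 (isolated⇒rd≡0 T (suc n) (isolated-outside T (suc n) λ _ n<ℓ →
                      contradiction (n<ℓ⇒m≤ℓ+1 n<ℓ) m≰ℓ+1))

  rightLoad′ : ∀ {a b} → b ≤ 2 → Boundary a b → ld T Q + b ≤ 2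
  rightLoad′ b≤2 B with m ≤? ℓ + 1
  ... | yes m≤ℓ+1 = Boundary.rightLoad B m≤ℓ+1
  ... | no  m≰ℓ+1 =
    0+≤2 b≤2 (cong (ld T) (m≤n⇒m∸n≡0 (subst (_≤ m) (sym (+-suc ℓ 1)) (≰⇒> m≰ℓ+1))))

  leftGap₂ : ∀ {b} → Boundary 2 b → ∀ j → j ≤ suc n → rd T j ≡ 0
  leftGap₂ B j j≤1+n with m≤n⇒m<n∨m≡n j≤1+n
  ... | inj₁ j<1+n = Boundary.leftGap B z<s j (s≤s⁻¹ j<1+n)
  ... | inj₂ refl  = 2+≤2⇒≡0 (leftLoad′ ≤-refl B)

  rightGap₂ : ∀ {a} → Boundary a 2 → ∀ i → Q ≤ i → ld T i ≡ 0
  rightGap₂ B i Q≤i with m≤n⇒m<n∨m≡n Q≤i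
  ... | inj₁ Q<i = Boundary.rightGap B z<s i (≤-trans ℓ+3∸m≤1+Q Q<i)
  ... | inj₂ refl = 2+≤2⇒≡0 (subst (_≤ 2) (+-comm (ld T Q) 2) (rightLoad′ ≤-refl B))

  narrow : ∀ {a b} → Boundary a b → 0 < a → 0 < b → ¬ (a + b ≤ 2) → m ≤ ℓ + 1
  narrow B 0<a 0<b a+b≰2 with m≤n⇒m<n∨m≡n (Boundary.span B 0<a 0<b)
  ... | inj₁ m<ℓ+2 = s≤s⁻¹ (subst (m <_) (+-suc ℓ 1) m<ℓ+2)
  ... | inj₂ m≡ℓ+2 = contradiction (Boundary.meet B m≡ℓ+2) a+b≰2

  boundary₀₀ : Boundary 0 0
  boundary₀₀ = record
    { leftGap   = λ ()
    ; rightGap  = λ ()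
    ; span      = λ ()
    ; leftLoad  = λ _ → rd≤2 (m ∸ 1)
    ; rightLoad = λ _ → +0≤2 (ld≤2 Q) refl
    ; meet      = λ _ → z≤n }

  Characterization₁₀ : Set
  Characterization₁₀ = (ℓ ≡ 0) ⊎ ((ℓ + 3 ≤ m) × AllIsolated)
                       ⊎ ((m ≤ ℓ + 2) × PrefixIsolated 2 × IsTypeG m (sub T (m ∸ 1) ℓ))

  boundary₁₀ : Boundary 1 0 ⇔ Characterization₁₀
  boundary₁₀ = mk⇔ necessary sufficient
    where
    necessary : Boundary 1 0 → Characterization₁₀
    necessary B = by-cases (m ≤? ℓ + 2)
      where
      prefix = isolated-below T n (Boundary.leftGap B z<s)
      module W = Substructure T n ℓ ≤-refl prefix (isolated-beyond T)
      by-cases : Dec (m ≤ ℓ + 2) → Characterization₁₀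
      by-cases (yes m≤ℓ+2) = inj₂ (inj₂ (m≤ℓ+2 , from (prefixIsolated⇔ 2 2≤m) prefix
        , W.sub-reduced (suc n) R , from W.first-deg≤1⇔ (s≤s⁻¹ (leftLoad′ 1≤2 B))))
      by-cases (no m≰ℓ+2) = inj₂ (inj₁ (ℓ+3≤m , from allIsolated⇔
        (isolated-everywhere T n (suc ℓ) 1+ℓ≤1+n prefix (isolated-beyond T))))
        where
        ℓ+3≤m : ℓ + 3 ≤ m
        ℓ+3≤m = subst (_≤ m) (sym (+-suc ℓ 2)) (≰⇒> m≰ℓ+2)
        1+ℓ≤1+n : suc ℓ ≤ suc n
        1+ℓ≤1+n = ≤-trans (s≤s⁻¹ (s≤s⁻¹ (subst (_≤ m) (+-comm ℓ 3) ℓ+3≤m))) (n≤1+n n)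
    sufficient : Characterization₁₀ → Boundary 1 0
    sufficient (inj₁ ℓ≡0) =
      boundary-of-isolated (to allIsolated⇔ all) 1≤2 z≤n (λ _ ()) (λ _ → 1≤2)
      where
      all : AllIsolated
      all v 1≤v v≤ℓ = contradiction (≤-trans 1≤v (subst (v ≤_) ℓ≡0 v≤ℓ)) λ ()
    sufficient (inj₂ (inj₁ (_ , all))) =
      boundary-of-isolated (to allIsolated⇔ all) 1≤2 z≤n (λ _ ()) (λ _ → 1≤2)
    sufficient (inj₂ (inj₂ (_ , pre , _ , first≤1))) = record
      { leftGap   = λ _ j j≤n → isolated⇒rd≡0 T j (prefix j j≤n)
      ; rightGap  = λ ()
      ; span      = λ _ ()
      ; leftLoad  = λ _ → s≤s (to W.first-deg≤1⇔ first≤1)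
      ; rightLoad = λ _ → +0≤2 (ld≤2 Q) refl
      ; meet      = λ _ → 1≤2 }
      where
      prefix = to (prefixIsolated⇔ 2 2≤m) pre
      module W = Substructure T n ℓ ≤-refl prefix (isolated-beyond T)

  Characterization₁₁ : Set
  Characterization₁₁ = ((m ≤ ℓ + 2) × (ℓ + 5 ≤ 2 * m) × AllIsolated)
                       ⊎ ((2 * m ≤ ℓ + 4) × PrefixIsolated 2 × SuffixIsolated 3
                          × IsTypeH m (sub T (m ∸ 1) Q))

  boundary₁₁ : Boundary 1 1 ⇔ Characterization₁₁
  boundary₁₁ = mk⇔ necessary sufficient
    where
    necessary : Boundary 1 1 → Characterization₁₁
    necessary B = by-cases (2 * m ≤? ℓ + 4)
      where
      prefix = isolated-below T n (Boundary.leftGap B z<s)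
      suffix = isolated-from T (ℓ + 3 ∸ m) (Boundary.rightGap B z<s)
      module W = Substructure T n Q Q≤ℓ prefix (λ v Q<v → suffix v (≤-trans ℓ+3∸m≤1+Q Q<v))
      by-cases : Dec (2 * m ≤ ℓ + 4) → Characterization₁₁
      by-cases (yes 2m≤ℓ+4) = inj₂ (2m≤ℓ+4 , from (prefixIsolated⇔ 2 2≤m) prefix
        , from (suffixIsolated⇔ 3) suffix , W.sub-reduced (suc n) R
        , from W.ends-deg≤1⇔ (s≤s⁻¹ (leftLoad′ 1≤2 B) , to +1≤2⇔≤1 (rightLoad′ 1≤2 B)))
      by-cases (no 2m≰ℓ+4) = inj₁ (Boundary.span B z<s z<s , ℓ+5≤2m , from allIsolated⇔
        (isolated-everywhere T n (ℓ + 3 ∸ m) ℓ+3∸m≤1+n prefix suffix))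
        where
        ℓ+5≤2m : ℓ + 5 ≤ 2 * m
        ℓ+5≤2m = subst (_≤ 2 * m) (sym (+-suc ℓ 4)) (≰⇒> 2m≰ℓ+4)
        ℓ+3∸m≤1+n : ℓ + 3 ∸ m ≤ suc n
        ℓ+3∸m≤1+n = from (∸≤⇔≤+ (ℓ + 3) m (suc n)) (≤-trans (+-monoʳ-≤ ℓ (n≤1+n 3))
          (s≤s⁻¹ (subst₂ _≤_ (+-suc ℓ 4) (trans 2*m≡m+m (+-suc m (suc n))) ℓ+5≤2m)))
    sufficient : Characterization₁₁ → Boundary 1 1
    sufficient (inj₁ (m≤ℓ+2 , _ , all)) =
      boundary-of-isolated (to allIsolated⇔ all) 1≤2 1≤2 (λ _ _ → m≤ℓ+2) (λ _ → ≤-refl)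
    sufficient (inj₂ (2m≤ℓ+4 , pre , suf , _ , ends≤1)) = record
      { leftGap   = λ _ j j≤n → isolated⇒rd≡0 T j (prefix j j≤n)
      ; rightGap  = λ _ i in-zone → isolated⇒ld≡0 T i (suffix i in-zone)
      ; span      = λ _ _ → 2*m≤ℓ+[c+2]⇒m≤ℓ+c 2 2m≤ℓ+4
      ; leftLoad  = λ _ → s≤s (proj₁ (to W.ends-deg≤1⇔ ends≤1))
      ; rightLoad = λ _ → from +1≤2⇔≤1 (proj₂ (to W.ends-deg≤1⇔ ends≤1))
      ; meet      = λ _ → ≤-refl }
      where
      prefix = to (prefixIsolated⇔ 2 2≤m) pre
      suffix = to (suffixIsolated⇔ 3) suf
      module W = Substructure T n Q Q≤ℓ prefix (λ v Q<v → suffix v (≤-trans ℓ+3∸m≤1+Q Q<v))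

  Characterization₂₀ : Set
  Characterization₂₀ = ((ℓ + 2 ≤ m) × AllIsolated) ⊎ ((m ≤ ℓ + 1) × PrefixIsolated 1)

  boundary₂₀ : Boundary 2 0 ⇔ Characterization₂₀
  boundary₂₀ = mk⇔ necessary sufficient
    where
    necessary : Boundary 2 0 → Characterization₂₀
    necessary B = by-cases (m ≤? ℓ + 1)
      where
      prefix = isolated-below T (suc n) (leftGap₂ B)
      by-cases : Dec (m ≤ ℓ + 1) → Characterization₂₀
      by-cases (yes m≤ℓ+1) = inj₂ (m≤ℓ+1 , from (prefixIsolated⇔ 1 1≤m) prefix)
      by-cases (no m≰ℓ+1) = inj₁ (ℓ+2≤m , from allIsolated⇔
        (isolated-everywhere T (suc n) (suc ℓ) (s≤s ℓ≤1+n) prefix (isolated-beyond T)))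
        where
        ℓ+2≤m : ℓ + 2 ≤ m
        ℓ+2≤m = subst (_≤ m) (sym (+-suc ℓ 1)) (≰⇒> m≰ℓ+1)
        ℓ≤1+n : ℓ ≤ suc n
        ℓ≤1+n = s≤s⁻¹ (≤-trans (s≤s (m≤n+m ℓ 1)) (subst (_≤ m) (+-comm ℓ 2) ℓ+2≤m))
    sufficient : Characterization₂₀ → Boundary 2 0
    sufficient (inj₁ (_ , all)) =
      boundary-of-isolated (to allIsolated⇔ all) ≤-refl z≤n (λ _ ()) (λ _ → ≤-refl)
    sufficient (inj₂ (_ , pre)) = record
      { leftGap   = λ _ j j≤n → isolated⇒rd≡0 T j (prefix j (m≤n⇒m≤1+n j≤n))
      ; rightGap  = λ ()
      ; span      = λ _ ()
      ; leftLoad  = λ _ → +0≤2 ≤-refl (isolated⇒rd≡0 T (suc n) (prefix (suc n) ≤-refl))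
      ; rightLoad = λ _ → +0≤2 (ld≤2 Q) refl
      ; meet      = λ _ → ≤-refl }
      where
      prefix = to (prefixIsolated⇔ 1 1≤m) pre

  Characterization₂₁ : Set
  Characterization₂₁ = ((m ≤ ℓ + 1) × (ℓ + 4 ≤ 2 * m) × AllIsolated)
                       ⊎ ((2 * m ≤ ℓ + 3) × PrefixIsolated 1 × SuffixIsolated 3
                          × EmptyOrLastDegLe1 (sub T m Q))

  boundary₂₁ : Boundary 2 1 ⇔ Characterization₂₁
  boundary₂₁ = mk⇔ necessary sufficient
    where
    necessary : Boundary 2 1 → Characterization₂₁
    necessary B = by-cases (2 * m ≤? ℓ + 3)
      where
      prefix = isolated-below T (suc n) (leftGap₂ B)
      suffix = isolated-from T (ℓ + 3 ∸ m) (Boundary.rightGap B z<s)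
      module W = Substructure T (suc n) Q Q≤ℓ prefix (λ v Q<v → suffix v (≤-trans ℓ+3∸m≤1+Q Q<v))
      by-cases : Dec (2 * m ≤ ℓ + 3) → Characterization₂₁
      by-cases (yes 2m≤ℓ+3) = inj₂ (2m≤ℓ+3 , from (prefixIsolated⇔ 1 1≤m) prefix
        , from (suffixIsolated⇔ 3) suffix , from W.last-deg≤1⇔ (to +1≤2⇔≤1 (rightLoad′ 1≤2 B)))
      by-cases (no 2m≰ℓ+3) = inj₁ (narrow B z<s z<s (λ { (s≤s (s≤s ())) }) , ℓ+4≤2m ,
        from allIsolated⇔ (isolated-everywhere T (suc n) (ℓ + 3 ∸ m) ℓ+3∸m≤m prefix suffix))
        where
        ℓ+4≤2m : ℓ + 4 ≤ 2 * m
        ℓ+4≤2m = subst (_≤ 2 * m) (sym (+-suc ℓ 3)) (≰⇒> 2m≰ℓ+3)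
        ℓ+3∸m≤m : ℓ + 3 ∸ m ≤ m
        ℓ+3∸m≤m = from (∸≤⇔≤+ (ℓ + 3) m m)
          (≤-trans (+-monoʳ-≤ ℓ (n≤1+n 3)) (subst (ℓ + 4 ≤_) 2*m≡m+m ℓ+4≤2m))
    sufficient : Characterization₂₁ → Boundary 2 1
    sufficient (inj₁ (m≤ℓ+1 , _ , all)) = boundary-of-isolated (to allIsolated⇔ all) ≤-refl 1≤2
      (λ _ _ → m≤ℓ+1⇒m≤ℓ+2 m≤ℓ+1)
      (λ m≡ℓ+2 → contradiction m≡ℓ+2 (m≤ℓ+1⇒m≢ℓ+2 m≤ℓ+1))
    sufficient (inj₂ (2m≤ℓ+3 , pre , suf , last≤1)) = record
      { leftGap   = λ _ j j≤n → isolated⇒rd≡0 T j (prefix j (m≤n⇒m≤1+n j≤n))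
      ; rightGap  = λ _ i in-zone → isolated⇒ld≡0 T i (suffix i in-zone)
      ; span      = λ _ _ → m≤ℓ+1⇒m≤ℓ+2 m≤ℓ+1
      ; leftLoad  = λ _ → +0≤2 ≤-refl (isolated⇒rd≡0 T (suc n) (prefix (suc n) ≤-refl))
      ; rightLoad = λ _ → from +1≤2⇔≤1 (to W.last-deg≤1⇔ last≤1)
      ; meet      = λ m≡ℓ+2 → contradiction m≡ℓ+2 (m≤ℓ+1⇒m≢ℓ+2 m≤ℓ+1) }
      where
      m≤ℓ+1 : m ≤ ℓ + 1
      m≤ℓ+1 = 2*m≤ℓ+[c+2]⇒m≤ℓ+c 1 2m≤ℓ+3
      prefix = to (prefixIsolated⇔ 1 1≤m) pre
      suffix = to (suffixIsolated⇔ 3) suf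
      module W = Substructure T (suc n) Q Q≤ℓ prefix (λ v Q<v → suffix v (≤-trans ℓ+3∸m≤1+Q Q<v))

  Characterization₂₂ : Set
  Characterization₂₂ = ((m ≤ ℓ + 1) × (ℓ + 3 ≤ 2 * m) × AllIsolated)
                       ⊎ ((2 * m ≤ ℓ + 2) × PrefixIsolated 1 × SuffixIsolated 2)

  boundary₂₂ : Boundary 2 2 ⇔ Characterization₂₂
  boundary₂₂ = mk⇔ necessary sufficient
    where
    necessary : Boundary 2 2 → Characterization₂₂
    necessary B = by-cases (2 * m ≤? ℓ + 2)
      where
      prefix = isolated-below T (suc n) (leftGap₂ B)
      suffix = isolated-from T Q (rightGap₂ B)
      by-cases : Dec (2 * m ≤ ℓ + 2) → Characterization₂₂
      by-cases (yes 2m≤ℓ+2) =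
        inj₂ (2m≤ℓ+2 , from (prefixIsolated⇔ 1 1≤m) prefix , from (suffixIsolated⇔ 2) suffix)
      by-cases (no 2m≰ℓ+2) = inj₁ (narrow B z<s z<s (λ { (s≤s (s≤s ())) }) , ℓ+3≤2m ,
        from allIsolated⇔ (isolated-everywhere T (suc n) Q Q≤m prefix suffix))
        where
        ℓ+3≤2m : ℓ + 3 ≤ 2 * m
        ℓ+3≤2m = subst (_≤ 2 * m) (sym (+-suc ℓ 2)) (≰⇒> 2m≰ℓ+2)
        Q≤m : Q ≤ m
        Q≤m = from (∸≤⇔≤+ (ℓ + 2) m m)
          (≤-trans (+-monoʳ-≤ ℓ (n≤1+n 2)) (subst (ℓ + 3 ≤_) 2*m≡m+m ℓ+3≤2m))
    sufficient : Characterization₂₂ → Boundary 2 2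
    sufficient (inj₁ (m≤ℓ+1 , _ , all)) = boundary-of-isolated (to allIsolated⇔ all) ≤-refl ≤-refl
      (λ _ _ → m≤ℓ+1⇒m≤ℓ+2 m≤ℓ+1)
      (λ m≡ℓ+2 → contradiction m≡ℓ+2 (m≤ℓ+1⇒m≢ℓ+2 m≤ℓ+1))
    sufficient (inj₂ (2m≤ℓ+2 , pre , suf)) = record
      { leftGap   = λ _ j j≤n → isolated⇒rd≡0 T j (prefix j (m≤n⇒m≤1+n j≤n))
      ; rightGap  = λ _ i in-zone → isolated⇒ld≡0 T i (suffix i (≤-trans Q≤ℓ+3∸m in-zone))
      ; span      = λ _ _ → m≤ℓ+1⇒m≤ℓ+2 m≤ℓ+1
      ; leftLoad  = λ _ → +0≤2 ≤-refl (isolated⇒rd≡0 T (suc n) (prefix (suc n) ≤-refl))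
      ; rightLoad = λ _ → 0+≤2 ≤-refl (isolated⇒ld≡0 T Q (suffix Q ≤-refl))
      ; meet      = λ m≡ℓ+2 → contradiction m≡ℓ+2 (m≤ℓ+1⇒m≢ℓ+2 m≤ℓ+1) }
      where
      m≤ℓ+1 : m ≤ ℓ + 1
      m≤ℓ+1 = ≤-trans (2*m≤ℓ+[c+2]⇒m≤ℓ+c 0 2m≤ℓ+2) (+-monoʳ-≤ ℓ z≤n)
      prefix = to (prefixIsolated⇔ 1 1≤m) pre
      suffix = to (suffixIsolated⇔ 2) suf

mainTheorem10 : (m ℓ : ℕ) → 2 ≤ m → (T : Diagram ℓ) → IsReduced m T →
    HasType m T 0 0
    × (HasType m T 1 0 ⇔
        ((ℓ ≡ 0)
         ⊎ ((ℓ + 3 ≤ m) × (∀ v → 1 ≤ v → v ≤ ℓ → isolated T v))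
         ⊎ ((m ≤ ℓ + 2) × (∀ v → 1 ≤ v → v + 2 ≤ m → isolated T v)
            × IsTypeG m (sub T (m ∸ 1) ℓ))))
    × (HasType m T 1 1 ⇔
        (((m ≤ ℓ + 2) × (ℓ + 5 ≤ 2 * m) × (∀ v → 1 ≤ v → v ≤ ℓ → isolated T v))
         ⊎ ((2 * m ≤ ℓ + 4) × (∀ v → 1 ≤ v → v + 2 ≤ m → isolated T v)
            × (∀ v → ℓ + 3 ≤ v + m → v ≤ ℓ → isolated T v)
            × IsTypeH m (sub T (m ∸ 1) (ℓ + 2 ∸ m)))))
    × (HasType m T 2 0 ⇔
        (((ℓ + 2 ≤ m) × (∀ v → 1 ≤ v → v ≤ ℓ → isolated T v))
         ⊎ ((m ≤ ℓ + 1) × (∀ v → 1 ≤ v → v + 1 ≤ m → isolated T v))))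
    × (HasType m T 2 1 ⇔
        (((m ≤ ℓ + 1) × (ℓ + 4 ≤ 2 * m) × (∀ v → 1 ≤ v → v ≤ ℓ → isolated T v))
         ⊎ ((2 * m ≤ ℓ + 3) × (∀ v → 1 ≤ v → v + 1 ≤ m → isolated T v)
            × (∀ v → ℓ + 3 ≤ v + m → v ≤ ℓ → isolated T v)
            × EmptyOrLastDegLe1 (sub T m (ℓ + 2 ∸ m)))))
    × (HasType m T 2 2 ⇔
        (((m ≤ ℓ + 1) × (ℓ + 3 ≤ 2 * m) × (∀ v → 1 ≤ v → v ≤ ℓ → isolated T v))
         ⊎ ((2 * m ≤ ℓ + 2) × (∀ v → 1 ≤ v → v + 1 ≤ m → isolated T v)
            × (∀ v → ℓ + 2 ≤ v + m → v ≤ ℓ → isolated T v))))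
mainTheorem10 (suc (suc n)) ℓ (s≤s (s≤s z≤n)) T R =
    boundary⇒hasType boundary₀₀
  , ⇔-trans (hasType⇔boundary 1 0) boundary₁₀
  , ⇔-trans (hasType⇔boundary 1 1) boundary₁₁
  , ⇔-trans (hasType⇔boundary 2 0) boundary₂₀
  , ⇔-trans (hasType⇔boundary 2 1) boundary₂₁
  , ⇔-trans (hasType⇔boundary 2 2) boundary₂₂
  where open ReducedStack n ℓ T R
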